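{- Let $a,b$ be distinct letters of a finite alphabet $A$, let $u,v,w\in A^*$ be words of length $n$ with $alph(w)=\{a,b\}$, let $I,J,K\subseteq[n]$ be the sets of positions at which $b$ occurs in $u,v,w$ respectively, and let $m\ge0$ be an integer with $m\neq1$. For $X\subseteq[n]$ put $N_n(X)=\sum_{i\in X}(-1)^{i-1}\binom{n-1}{i-1}$. (i) If $m\nmid N_n(K)$ then $w$ lies in the support of $\mathcal{L}_{\mathbb{Z}_m}(A)$. In particular, if $m=p$ is prime, $n=p^e$ and $p\nmid|K|$, then $w$ lies in the support of $\mathcal{L}_{\mathbb{Z}_m}(A)$. (ii) If $u,v$ is a twin pair with respect to $\mathcal{L}_{\mathbb{Z}_m}(A)$ then $N_n(I)\equiv N_n(J)\pmod m$. (iii) If $u,v$ is an anti-twin pair with respect to $\mathcal{L}_{\mathbb{Z}_m}(A)$ then $N_n(I)\equiv -N_n(J)\pmod m$.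
   Context: $[n]=\{1,\dots,n\}$; $alph(w)$ is the set of letters occurring in $w$. $\mathbb{Z}_m=\mathbb{Z}/m\mathbb{Z}$ (so $\mathbb{Z}_0=\mathbb{Z}$), and congruence mod $0$ means equality. For a commutative ring $K$ with unity, $\mathcal{L}_K(A)$ is the Lie subalgebra (bracket $[P,Q]=PQ-QP$) of the free associative algebra $K\langle A\rangle$ generated by $A$; $(P,w)$ denotes the coefficient of the word $w$ in $P$. The support of $\mathcal{L}_K(A)$ is the set of words $w$ with $(P,w)\neq0$ for some $P\in\mathcal{L}_K(A)$. A pair $u,v$ is twin (resp. anti-twin) with respect to $\mathcal{L}_K(A)$ if $(Q,u)=(Q,v)$ (resp. $(Q,u)=-(Q,v)$) for all $Q\in\mathcal{L}_K(A)$. -}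

module Defs where

open import Data.Nat as ℕ using (ℕ; zero; suc; _∸_)
open import Data.Nat.Combinatorics using (_C_)
open import Data.Integer as ℤ using (ℤ; +_; _+_; _*_; -_; _-_)
open import Data.Integer.Divisibility as ℤD using ()
open import Data.Fin using (Fin; toℕ; _≟_)
open import Data.Fin.Subset using (Subset)
open import Data.Vec as V using (Vec; lookup; toList)
open import Data.List as L using (List; []; _∷_; _++_; allFin; foldr)
open import Data.List.Properties using (≡-dec)
open import Data.Product using (_×_; _,_; Σ; ∃)
open import Data.Bool using (Bool; if_then_else_)
open import Relation.Nullary using (¬_)
open import Relation.Nullary.Decidable using (⌊_⌋)

Word : ℕ → Set
Word k = List (Fin k)

-- Congruence of integers modulo m (m = 0 means equality); Z_m = Z/mZ
-- is represented by integers up to this congruence.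
_≡_[mod_] : ℤ → ℤ → ℕ → Set
x ≡ y [mod m ] = (+ m) ℤD.∣ (x - y)

-- Noncommutative polynomials with integer representatives of Z_m
-- coefficients: formal finite sums  Σ c · w  given as lists of terms.
Poly : ℕ → Set
Poly k = List (ℤ × Word k)

coeff : ∀ {k} → Poly k → Word k → ℤ
coeff P w = foldr (λ t acc → if ⌊ ≡-dec _≟_ (Data.Product.proj₂ t) w ⌋
                               then Data.Product.proj₁ t + acc else acc) (+ 0) P
  where import Data.Product

letter : ∀ {k} → Fin k → Poly k
letter a = (+ 1 , a ∷ []) ∷ []

scale : ∀ {k} → ℤ → Poly k → Poly k
scale c = L.map (λ { (d , w) → (c * d , w) })

mulP : ∀ {k} → Poly k → Poly k → Poly k
mulP P Q = L.concatMap (λ { (c , u) → L.map (λ { (d , v) → (c * d , u ++ v) }) Q }) P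

bracket : ∀ {k} → Poly k → Poly k → Poly k
bracket P Q = mulP P Q ++ scale (- (+ 1)) (mulP Q P)

-- Representatives of elements of the Lie subalgebra of Z_m<A> generated
-- by A: closure of the letters under 0, +, scalar multiplication and [ , ].
data InLie {k : ℕ} : Poly k → Set where
  lie-gen   : (a : Fin k) → InLie (letter a)
  lie-zero  : InLie []
  lie-add   : ∀ {P Q} → InLie P → InLie Q → InLie (P ++ Q)
  lie-scale : ∀ {P} (c : ℤ) → InLie P → InLie (scale c P)
  lie-brk   : ∀ {P Q} → InLie P → InLie Q → InLie (bracket P Q)

InSupport : ∀ {k} → ℕ → Word k → Set
InSupport m w = Σ _ λ P → InLie P × ¬ (coeff P w ≡ + 0 [mod m ])

Twin : ∀ {k} → ℕ → Word k → Word k → Set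
Twin {k} m u v = (Q : Poly k) → InLie Q → coeff Q u ≡ coeff Q v [mod m ]

AntiTwin : ∀ {k} → ℕ → Word k → Word k → Set
AntiTwin {k} m u v = (Q : Poly k) → InLie Q → coeff Q u ≡ - coeff Q v [mod m ]

signPow : ℕ → ℤ
signPow zero = + 1
signPow (suc j) = - signPow j

-- N_n(X) = Σ_{i ∈ X} (-1)^{i-1} binom(n-1, i-1), positions 1..n encoded
-- as Fin n with i ↦ toℕ i + 1.
N : (n : ℕ) → Subset n → ℤ
N n X = foldr (λ i acc → (if lookup X i
                           then signPow (toℕ i) * + ((n ∸ 1) C toℕ i)
                           else + 0) + acc) (+ 0) (allFin n)

positions : ∀ {k n} → Fin k → Vec (Fin k) n → Subset n
positions b u = V.map (λ c → ⌊ c ≟ b ⌋) u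

Occurs : ∀ {k n} → Fin k → Vec (Fin k) n → Set
Occurs c w = ∃ λ i → lookup w i Relation.Binary.PropositionalEquality.≡ c
  where import Relation.Binary.PropositionalEquality

-- With Y the sum of all letters, the right-normed bracket R_j = [⋯[[b, Y], Y]⋯, Y]
-- lies in L(A), and [P, Y] has coefficient (P, z) − (P, x) at a word cx = zd.
-- Pascal's rule then shows by induction that the coefficient of a word x of
-- length j + 1 in R_j is Σ_{x_i = b} (−1)^(i−1) C(j, i−1), so for j = n − 1 it
-- is N_n of the b-positions of x; (i)–(iii) follow by testing R_{n−1}.
-- For n = p^e the prime p divides C(p^e, i) for 0 < i < p^e, and Pascal's rule
-- turns this into (−1)^i C(p^e − 1, i) ≡ 1 (mod p), whence N_n(K) ≡ |K| (mod p).

module Submission where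

open import Defs
open import Data.Nat using (ℕ; _^_)
open import Data.Nat.Divisibility using (_∣_)
open import Data.Nat.Primality using (Prime)
open import Data.Integer using (-_)
open import Data.Integer.Divisibility as ℤD using ()
open import Data.Fin using (Fin)
open import Data.Fin.Subset using (∣_∣)
open import Data.Vec using (Vec; toList; lookup)
open import Data.Product using (_×_)
open import Data.Sum using (_⊎_)
open import Relation.Nullary using (¬_)
open import Relation.Binary.PropositionalEquality using (_≡_; _≢_)

open import Data.Bool using (true; false; if_then_else_)
open import Data.Empty using (⊥-elim)
open import Data.Fin using (zero; suc; toℕ; _≟_)
open import Data.Fin.Properties using (toℕ<n)
open import Data.Fin.Subset using (Subset)
open import Data.Integer using (ℤ; +_; _+_; _*_; _-_)
import Data.Integer.Divisibility.Signed as Signed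
import Data.Integer.Properties as ℤₚ
open import Data.Integer.Tactic.RingSolver using (solve-∀)
open import Data.List using (List; []; _∷_; _++_; _∷ʳ_; map; foldr; tabulate; length)
open import Data.List.Properties using (≡-dec; map-cong; ∷ʳ-injectiveˡ; ∷ʳ-injectiveʳ; length-++)
open import Data.Nat using (zero; suc; _<_; _≤_; z≤n; s≤s; _∸_; NonZero)
open import Data.Nat.Combinatorics using (_C_; nCk+nC[k+1]≡[n+1]C[k+1]; nC1≡n)
open import Data.Nat.Combinatorics.Specification using (k>n⇒nCk≡0)
import Data.Nat as ℕ
import Data.Nat.Divisibility as ℕ∣
import Data.Nat.Properties as ℕₚ
open import Data.Nat.Primality using (euclidsLemma; prime⇒nonZero)
import Data.Nat.Tactic.RingSolver as ℕ-solver
open import Data.Product using (∃₂; _,_)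
open import Data.Sum using (inj₁; inj₂)
import Data.Vec as Vec
open import Data.Vec.Properties using (length-toList)
open import Function using (_∘_)
open import Relation.Nullary using (yes; no)
open import Relation.Nullary.Decidable using (⌊_⌋)
open import Relation.Binary.PropositionalEquality
  using (refl; sym; trans; cong; cong₂; subst; module ≡-Reasoning)

open import Algebra.Properties.Monoid.Sum ℤₚ.+-0-monoid using (sum)

open ≡-Reasoning

[k+1]*[n+1]C[k+1]≡[n+1]*nCk : ∀ n k → suc k ℕ.* (suc n C suc k) ≡ suc n ℕ.* (n C k)
[k+1]*[n+1]C[k+1]≡[n+1]*nCk zero    zero    = refl
[k+1]*[n+1]C[k+1]≡[n+1]*nCk zero    (suc k)
  rewrite k>n⇒nCk≡0 {1} {suc (suc k)} (s≤s (s≤s z≤n)) | k>n⇒nCk≡0 {0} {suc k} (s≤s z≤n)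
  = ℕₚ.*-zeroʳ (suc (suc k))
[k+1]*[n+1]C[k+1]≡[n+1]*nCk (suc n) zero
  rewrite nC1≡n (suc (suc n)) = trans (ℕₚ.+-identityʳ _) (sym (ℕₚ.*-identityʳ _))
[k+1]*[n+1]C[k+1]≡[n+1]*nCk (suc n) (suc k) = begin
  suc (suc k) ℕ.* (suc (suc n) C suc (suc k))
    ≡⟨ cong (suc (suc k) ℕ.*_) (sym (nCk+nC[k+1]≡[n+1]C[k+1] (suc n) (suc k))) ⟩
  suc (suc k) ℕ.* (x ℕ.+ y)
    ≡⟨ distribute k x y ⟩
  x ℕ.+ (suc k ℕ.* x ℕ.+ suc (suc k) ℕ.* y)
    ≡⟨ cong (x ℕ.+_) (cong₂ ℕ._+_ ([k+1]*[n+1]C[k+1]≡[n+1]*nCk n k)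
                                  ([k+1]*[n+1]C[k+1]≡[n+1]*nCk n (suc k))) ⟩
  x ℕ.+ (suc n ℕ.* (n C k) ℕ.+ suc n ℕ.* (n C suc k))
    ≡⟨ cong (x ℕ.+_) (sym (ℕₚ.*-distribˡ-+ (suc n) (n C k) (n C suc k))) ⟩
  x ℕ.+ suc n ℕ.* (n C k ℕ.+ n C suc k)
    ≡⟨ cong (λ z → x ℕ.+ suc n ℕ.* z) (nCk+nC[k+1]≡[n+1]C[k+1] n k) ⟩
  x ℕ.+ suc n ℕ.* x ∎
  where
  x = suc n C suc k
  y = suc n C suc (suc k)
  distribute : ∀ k x y → suc (suc k) ℕ.* (x ℕ.+ y) ≡ x ℕ.+ (suc k ℕ.* x ℕ.+ suc (suc k) ℕ.* y)
  distribute = ℕ-solver.solve-∀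

signedBinomial : ℕ → ℕ → ℤ
signedBinomial n i = signPow i * + (n C i)

signedBinomial-pascal : ∀ n i →
  signedBinomial (suc n) (suc i) ≡ signedBinomial n (suc i) - signedBinomial n i
signedBinomial-pascal n i = begin
  - σ * + (suc n C suc i)
    ≡⟨ cong (λ z → - σ * + z) (sym (nCk+nC[k+1]≡[n+1]C[k+1] n i)) ⟩
  - σ * (+ (n C i) + + (n C suc i))
    ≡⟨ expand σ (+ (n C i)) (+ (n C suc i)) ⟩
  - σ * + (n C suc i) - σ * + (n C i) ∎
  where
  σ = signPow i
  expand : ∀ σ x y → - σ * (x + y) ≡ - σ * y - σ * x
  expand = solve-∀

signedBinomial-out-of-range : ∀ {n i} → n < i → signedBinomial n i ≡ + 0
signedBinomial-out-of-range {i = i} n<i =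
  trans (cong (λ z → signPow i * + z) (k>n⇒nCk≡0 n<i)) (ℤₚ.*-zeroʳ (signPow i))

sumOver : ∀ {n} → Subset n → (Fin n → ℤ) → ℤ
sumOver X g = sum (λ i → if lookup X i then g i else + 0)

foldr-tabulate : ∀ {m n} (f : Fin n → ℤ) (g : Fin m → Fin n) →
  foldr (λ i acc → f i + acc) (+ 0) (tabulate g) ≡ sum (f ∘ g)
foldr-tabulate {zero}  f g = refl
foldr-tabulate {suc m} f g = cong (_+_ (f (g zero))) (foldr-tabulate f (g ∘ suc))

sumOver≡∣X∣-mod : ∀ {d n} (X : Subset n) (g : Fin n → ℤ) →
  (∀ i → d Signed.∣ (g i - + 1)) → d Signed.∣ (sumOver X g - + ∣ X ∣)
sumOver≡∣X∣-mod Vec.[] g _ = Signed.∣ᵤ⇒∣ (_ ℕ∣.∣0)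
sumOver≡∣X∣-mod (true Vec.∷ X) g g≡1 =
  subst (_ Signed.∣_) (regroup (g zero) (sumOver X (g ∘ suc)) (+ ∣ X ∣))
    (Signed.∣m∣n⇒∣m+n (g≡1 zero) (sumOver≡∣X∣-mod X (g ∘ suc) (g≡1 ∘ suc)))
  where
  regroup : ∀ x s c → (x - + 1) + (s - c) ≡ (x + s) - (+ 1 + c)
  regroup = solve-∀
sumOver≡∣X∣-mod (false Vec.∷ X) g g≡1 =
  subst (λ s → _ Signed.∣ (s - + ∣ X ∣)) (sym (ℤₚ.+-identityˡ (sumOver X (g ∘ suc))))
    (sumOver≡∣X∣-mod X (g ∘ suc) (g≡1 ∘ suc))

N-as-sumOver : ∀ n (X : Subset n) → N n X ≡ sumOver X (signedBinomial (n ∸ 1) ∘ toℕ)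
N-as-sumOver n X =
  foldr-tabulate (λ i → if lookup X i then signedBinomial (n ∸ 1) (toℕ i) else + 0) (λ i → i)

module _ {p : ℕ} (p-prime : Prime p) where

  private instance
    p≢0 : NonZero p
    p≢0 = prime⇒nonZero p-prime

  p^e∣m*n⇒p∤n⇒p^e∣m : ∀ e m n → p ^ e ∣ m ℕ.* n → ¬ p ∣ n → p ^ e ∣ m
  p^e∣m*n⇒p∤n⇒p^e∣m zero    m n _       _   = ℕ∣.1∣ m
  p^e∣m*n⇒p∤n⇒p^e∣m (suc e) m n p^e∣m*n p∤n
    with euclidsLemma m n p-prime (ℕ∣.∣-trans (ℕ∣.m∣m*n (p ^ e)) p^e∣m*n)
  ... | inj₂ p∣n = ⊥-elim (p∤n p∣n)
  ... | inj₁ (ℕ∣.divides q refl) =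
    subst (p ℕ.* p ^ e ∣_) (ℕₚ.*-comm p q) (ℕ∣.*-monoʳ-∣ p p^e∣q)
    where
    reassociate : ∀ q p n → q ℕ.* p ℕ.* n ≡ p ℕ.* (q ℕ.* n)
    reassociate = ℕ-solver.solve-∀
    p^e∣q : p ^ e ∣ q
    p^e∣q = p^e∣m*n⇒p∤n⇒p^e∣m e q n
      (ℕ∣.*-cancelˡ-∣ p (subst (p ℕ.* p ^ e ∣_) (reassociate q p n) p^e∣m*n)) p∤n

  -- (i + 1) C(p^e, i + 1) = p^e C(p^e − 1, i), so if p ∤ C(p^e, i + 1) then p^e ∣ i + 1 < p^e.
  p∣[p^e]C[1+i] : ∀ e {n i} → suc n ≡ p ^ e → i < n → p ∣ suc n C suc i
  p∣[p^e]C[1+i] e {n} {i} 1+n≡p^e i<n with p ℕ∣.∣? (suc n C suc i)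
  ... | yes p∣C = p∣C
  ... | no  p∤C = ⊥-elim (ℕₚ.<⇒≱ (s≤s i<n) (ℕ∣.∣⇒≤ p^e∣1+i))
    where
    p^e∣1+i : suc n ∣ suc i
    p^e∣1+i = subst (λ q → q ∣ suc i) (sym 1+n≡p^e)
      (p^e∣m*n⇒p∤n⇒p^e∣m e (suc i) (suc n C suc i)
        (subst (λ q → q ∣ suc i ℕ.* (suc n C suc i)) 1+n≡p^e
          (subst (suc n ∣_) (sym ([k+1]*[n+1]C[k+1]≡[n+1]*nCk n i)) (ℕ∣.m∣m*n (n C i))))
        p∤C)

  signedBinomial[p^e∸1]≡1-mod-p : ∀ e {n} → suc n ≡ p ^ e →
    ∀ i → i ≤ n → (+ p) Signed.∣ (signedBinomial n i - + 1)
  signedBinomial[p^e∸1]≡1-mod-p _ _ zero    _   = Signed.∣ᵤ⇒∣ (p ℕ∣.∣0)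
  signedBinomial[p^e∸1]≡1-mod-p e {n} 1+n≡p^e (suc i) i<n =
    subst ((+ p) Signed.∣_) regroup
      (Signed.∣m∣n⇒∣m+n p∣next (signedBinomial[p^e∸1]≡1-mod-p e 1+n≡p^e i (ℕₚ.<⇒≤ i<n)))
    where
    p∣next : (+ p) Signed.∣ signedBinomial (suc n) (suc i)
    p∣next = Signed.∣n⇒∣m*n (signPow (suc i)) {+ (suc n C suc i)}
               (Signed.∣ᵤ⇒∣ (p∣[p^e]C[1+i] e 1+n≡p^e i<n))
    shuffle : ∀ y z → (y - z) + (z - + 1) ≡ y - + 1
    shuffle = solve-∀
    regroup : signedBinomial (suc n) (suc i) + (signedBinomial n i - + 1)
            ≡ signedBinomial n (suc i) - + 1
    regroup = trans (cong (_+ (signedBinomial n i - + 1)) (signedBinomial-pascal n i))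
                    (shuffle (signedBinomial n (suc i)) (signedBinomial n i))

  N[p^e]≡∣X∣-mod-p : ∀ e {n} → suc n ≡ p ^ e → (X : Subset (suc n)) →
    (+ p) Signed.∣ (N (suc n) X - + ∣ X ∣)
  N[p^e]≡∣X∣-mod-p e {n} 1+n≡p^e X =
    subst (λ s → (+ p) Signed.∣ (s - + ∣ X ∣)) (sym (N-as-sumOver (suc n) X))
      (sumOver≡∣X∣-mod X (signedBinomial n ∘ toℕ)
        (λ i → signedBinomial[p^e∸1]≡1-mod-p e 1+n≡p^e (toℕ i) (ℕₚ.≤-pred (toℕ<n i))))

  p∤∣X∣⇒p∤N[p^e] : ∀ e {n} → suc n ≡ p ^ e → (X : Subset (suc n)) →
    ¬ p ∣ ∣ X ∣ → ¬ (+ p) ℤD.∣ N (suc n) X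
  p∤∣X∣⇒p∤N[p^e] e {n} 1+n≡p^e X p∤∣X∣ p∣N =
    p∤∣X∣ (Signed.∣⇒∣ᵤ (subst ((+ p) Signed.∣_) (cancel (N (suc n) X) (+ ∣ X ∣))
      (Signed.∣m∣n⇒∣m-n {m = N (suc n) X} (Signed.∣ᵤ⇒∣ p∣N)
        (N[p^e]≡∣X∣-mod-p e 1+n≡p^e X))))
    where
    cancel : ∀ x c → x - (x - c) ≡ c
    cancel = solve-∀

module _ {k : ℕ} where

  δ : Word k → Word k → ℤ → ℤ
  δ v w x = if ⌊ ≡-dec _≟_ v w ⌋ then x else + 0

  δ₁ : Fin k → Fin k → ℤ
  δ₁ c d = if ⌊ c ≟ d ⌋ then + 1 else + 0

  δ-∷ : ∀ c d v w x → δ (c ∷ v) (d ∷ w) x ≡ δ₁ c d * δ v w x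
  δ-∷ c d v w x with c ≟ d | ≡-dec _≟_ v w
  ... | yes _ | yes _ = sym (ℤₚ.*-identityˡ x)
  ... | yes _ | no _  = refl
  ... | no _  | _     = refl

  δ-∷ʳ : ∀ c d v w x → δ (v ∷ʳ c) (w ∷ʳ d) x ≡ δ₁ c d * δ v w x
  δ-∷ʳ c d v w x with ≡-dec _≟_ (v ∷ʳ c) (w ∷ʳ d) | c ≟ d | ≡-dec _≟_ v w
  ... | yes _  | yes _    | yes _    = sym (ℤₚ.*-identityˡ x)
  ... | yes eq | no c≢d   | _        = ⊥-elim (c≢d (∷ʳ-injectiveʳ v w eq))
  ... | yes eq | yes _    | no v≢w   = ⊥-elim (v≢w (∷ʳ-injectiveˡ v w eq))
  ... | no neq | yes refl | yes refl = ⊥-elim (neq refl)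
  ... | no _   | yes _    | no _     = refl
  ... | no _   | no _     | _        = refl

  δ-scale : ∀ v w c x → δ v w (c * x) ≡ c * δ v w x
  δ-scale v w c x with ⌊ ≡-dec _≟_ v w ⌋
  ... | true  = refl
  ... | false = sym (ℤₚ.*-zeroʳ c)

  coeff-∷ : ∀ x v (P : Poly k) w → coeff ((x , v) ∷ P) w ≡ δ v w x + coeff P w
  coeff-∷ x v P w with ⌊ ≡-dec _≟_ v w ⌋
  ... | true  = refl
  ... | false = sym (ℤₚ.+-identityˡ _)

  coeff-++ : ∀ (P Q : Poly k) w → coeff (P ++ Q) w ≡ coeff P w + coeff Q w
  coeff-++ [] Q w = sym (ℤₚ.+-identityˡ _)
  coeff-++ ((x , v) ∷ P) Q w = begin
    coeff ((x , v) ∷ P ++ Q) w          ≡⟨ coeff-∷ x v (P ++ Q) w ⟩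
    δ v w x + coeff (P ++ Q) w          ≡⟨ cong (_+_ (δ v w x)) (coeff-++ P Q w) ⟩
    δ v w x + (coeff P w + coeff Q w)   ≡⟨ sym (ℤₚ.+-assoc (δ v w x) _ _) ⟩
    δ v w x + coeff P w + coeff Q w     ≡⟨ cong (_+ coeff Q w) (sym (coeff-∷ x v P w)) ⟩
    coeff ((x , v) ∷ P) w + coeff Q w   ∎

  coeff-scale : ∀ c (P : Poly k) w → coeff (scale c P) w ≡ c * coeff P w
  coeff-scale c [] w = sym (ℤₚ.*-zeroʳ c)
  coeff-scale c ((x , v) ∷ P) w = begin
    coeff ((c * x , v) ∷ scale c P) w   ≡⟨ coeff-∷ (c * x) v (scale c P) w ⟩
    δ v w (c * x) + coeff (scale c P) w ≡⟨ cong₂ _+_ (δ-scale v w c x) (coeff-scale c P w) ⟩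
    c * δ v w x + c * coeff P w         ≡⟨ sym (ℤₚ.*-distribˡ-+ c _ _) ⟩
    c * (δ v w x + coeff P w)           ≡⟨ cong (c *_) (sym (coeff-∷ x v P w)) ⟩
    c * coeff ((x , v) ∷ P) w           ∎

  coeff-bracket : ∀ (P Q : Poly k) w →
    coeff (bracket P Q) w ≡ coeff (mulP P Q) w - coeff (mulP Q P) w
  coeff-bracket P Q w = begin
    coeff (bracket P Q) w
      ≡⟨ coeff-++ (mulP P Q) _ w ⟩
    coeff (mulP P Q) w + coeff (scale (- + 1) (mulP Q P)) w
      ≡⟨ cong (_+_ (coeff (mulP P Q) w)) (coeff-scale (- + 1) (mulP Q P) w) ⟩
    coeff (mulP P Q) w + - + 1 * coeff (mulP Q P) w
      ≡⟨ cong (_+_ (coeff (mulP P Q) w)) (ℤₚ.-1*i≡-i _) ⟩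
    coeff (mulP P Q) w - coeff (mulP Q P) w ∎

  monomialMul : ℤ → Word k → Poly k → Poly k
  monomialMul x u = map (λ (y , v) → (x * y , u ++ v))

  mulP-∷ : ∀ x u (P Q : Poly k) → mulP ((x , u) ∷ P) Q ≡ monomialMul x u Q ++ mulP P Q
  mulP-∷ x u P Q = cong (_++ mulP P Q) (map-cong (λ _ → refl) Q)

  letterSum : List (Fin k) → Poly k
  letterSum []       = []
  letterSum (c ∷ cs) = letter c ++ letterSum cs

  letterSum-lie : ∀ cs → InLie (letterSum cs)
  letterSum-lie []       = lie-zero
  letterSum-lie (c ∷ cs) = lie-add (lie-gen c) (letterSum-lie cs)

  multiplicity : List (Fin k) → Fin k → ℤ
  multiplicity []       d = + 0
  multiplicity (c ∷ cs) d = δ₁ c d + multiplicity cs d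

  coeff-letter* : ∀ c d (P : Poly k) w →
    coeff (monomialMul (+ 1) (c ∷ []) P) (d ∷ w) ≡ δ₁ c d * coeff P w
  coeff-letter* c d [] w = sym (ℤₚ.*-zeroʳ (δ₁ c d))
  coeff-letter* c d ((y , v) ∷ P) w = begin
    coeff ((+ 1 * y , c ∷ v) ∷ monomialMul (+ 1) (c ∷ []) P) (d ∷ w)
      ≡⟨ coeff-∷ (+ 1 * y) (c ∷ v) (monomialMul (+ 1) (c ∷ []) P) (d ∷ w) ⟩
    δ (c ∷ v) (d ∷ w) (+ 1 * y) + coeff (monomialMul (+ 1) (c ∷ []) P) (d ∷ w)
      ≡⟨ cong₂ _+_ (trans (δ-∷ c d v w (+ 1 * y)) (cong (λ z → δ₁ c d * δ v w z) (ℤₚ.*-identityˡ y)))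
                   (coeff-letter* c d P w) ⟩
    δ₁ c d * δ v w y + δ₁ c d * coeff P w
      ≡⟨ sym (ℤₚ.*-distribˡ-+ (δ₁ c d) _ _) ⟩
    δ₁ c d * (δ v w y + coeff P w)
      ≡⟨ cong (δ₁ c d *_) (sym (coeff-∷ y v P w)) ⟩
    δ₁ c d * coeff ((y , v) ∷ P) w ∎

  coeff-monomial*letterSum : ∀ x v cs w d →
    coeff (monomialMul x v (letterSum cs)) (w ∷ʳ d) ≡ multiplicity cs d * δ v w x
  coeff-monomial*letterSum x v []       w d = refl
  coeff-monomial*letterSum x v (c ∷ cs) w d = begin
    coeff ((x * + 1 , v ∷ʳ c) ∷ monomialMul x v (letterSum cs)) (w ∷ʳ d)
      ≡⟨ coeff-∷ (x * + 1) (v ∷ʳ c) (monomialMul x v (letterSum cs)) (w ∷ʳ d) ⟩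
    δ (v ∷ʳ c) (w ∷ʳ d) (x * + 1) + coeff (monomialMul x v (letterSum cs)) (w ∷ʳ d)
      ≡⟨ cong₂ _+_ (trans (cong (δ (v ∷ʳ c) (w ∷ʳ d)) (ℤₚ.*-identityʳ x)) (δ-∷ʳ c d v w x))
                   (coeff-monomial*letterSum x v cs w d) ⟩
    δ₁ c d * δ v w x + multiplicity cs d * δ v w x
      ≡⟨ sym (ℤₚ.*-distribʳ-+ (δ v w x) (δ₁ c d) _) ⟩
    multiplicity (c ∷ cs) d * δ v w x ∎

  coeff-letterSum* : ∀ cs (P : Poly k) d w →
    coeff (mulP (letterSum cs) P) (d ∷ w) ≡ multiplicity cs d * coeff P w
  coeff-letterSum* []       P d w = refl
  coeff-letterSum* (c ∷ cs) P d w = begin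
    coeff (mulP ((+ 1 , c ∷ []) ∷ letterSum cs) P) (d ∷ w)
      ≡⟨ cong (λ Q → coeff Q (d ∷ w)) (mulP-∷ (+ 1) (c ∷ []) (letterSum cs) P) ⟩
    coeff (monomialMul (+ 1) (c ∷ []) P ++ mulP (letterSum cs) P) (d ∷ w)
      ≡⟨ coeff-++ (monomialMul (+ 1) (c ∷ []) P) (mulP (letterSum cs) P) (d ∷ w) ⟩
    coeff (monomialMul (+ 1) (c ∷ []) P) (d ∷ w) + coeff (mulP (letterSum cs) P) (d ∷ w)
      ≡⟨ cong₂ _+_ (coeff-letter* c d P w) (coeff-letterSum* cs P d w) ⟩
    δ₁ c d * coeff P w + multiplicity cs d * coeff P w
      ≡⟨ sym (ℤₚ.*-distribʳ-+ (coeff P w) (δ₁ c d) _) ⟩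
    multiplicity (c ∷ cs) d * coeff P w ∎

  coeff-*letterSum : ∀ (P : Poly k) cs w d →
    coeff (mulP P (letterSum cs)) (w ∷ʳ d) ≡ multiplicity cs d * coeff P w
  coeff-*letterSum []            cs w d = sym (ℤₚ.*-zeroʳ (multiplicity cs d))
  coeff-*letterSum ((x , v) ∷ P) cs w d = begin
    coeff (mulP ((x , v) ∷ P) (letterSum cs)) (w ∷ʳ d)
      ≡⟨ cong (λ Q → coeff Q (w ∷ʳ d)) (mulP-∷ x v P (letterSum cs)) ⟩
    coeff (monomialMul x v (letterSum cs) ++ mulP P (letterSum cs)) (w ∷ʳ d)
      ≡⟨ coeff-++ (monomialMul x v (letterSum cs)) (mulP P (letterSum cs)) (w ∷ʳ d) ⟩
    coeff (monomialMul x v (letterSum cs)) (w ∷ʳ d) + coeff (mulP P (letterSum cs)) (w ∷ʳ d)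
      ≡⟨ cong₂ _+_ (coeff-monomial*letterSum x v cs w d) (coeff-*letterSum P cs w d) ⟩
    multiplicity cs d * δ v w x + multiplicity cs d * coeff P w
      ≡⟨ sym (ℤₚ.*-distribˡ-+ (multiplicity cs d) _ _) ⟩
    multiplicity cs d * (δ v w x + coeff P w)
      ≡⟨ cong (multiplicity cs d *_) (sym (coeff-∷ x v P w)) ⟩
    multiplicity cs d * coeff ((x , v) ∷ P) w ∎

alphabet : (k : ℕ) → List (Fin k)
alphabet zero    = []
alphabet (suc k) = zero ∷ map suc (alphabet k)

multiplicity-map-suc-zero : ∀ {k} (cs : List (Fin k)) → multiplicity (map suc cs) zero ≡ + 0
multiplicity-map-suc-zero []       = refl
multiplicity-map-suc-zero (c ∷ cs) = trans (ℤₚ.+-identityˡ _) (multiplicity-map-suc-zero cs)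

multiplicity-map-suc : ∀ {k} (cs : List (Fin k)) d →
  multiplicity (map suc cs) (suc d) ≡ multiplicity cs d
multiplicity-map-suc []       d = refl
multiplicity-map-suc (c ∷ cs) d with c ≟ d
... | yes _ = cong (_+_ (+ 1)) (multiplicity-map-suc cs d)
... | no  _ = cong (_+_ (+ 0)) (multiplicity-map-suc cs d)

multiplicity-alphabet : ∀ k (d : Fin k) → multiplicity (alphabet k) d ≡ + 1
multiplicity-alphabet (suc k) zero    = cong (_+_ (+ 1)) (multiplicity-map-suc-zero (alphabet k))
multiplicity-alphabet (suc k) (suc d) =
  trans (ℤₚ.+-identityˡ _) (trans (multiplicity-map-suc (alphabet k) d) (multiplicity-alphabet k d))

alphabetSum : (k : ℕ) → Poly k
alphabetSum k = letterSum (alphabet k)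

coeff-bracket-alphabetSum : ∀ {k} (P : Poly k) {c x w d} → c ∷ x ≡ w ∷ʳ d →
  coeff (bracket P (alphabetSum k)) (c ∷ x) ≡ coeff P w - coeff P x
coeff-bracket-alphabetSum {k} P {c} {x} {w} {d} c∷x≡w∷ʳd = begin
  coeff (bracket P (alphabetSum k)) (c ∷ x)
    ≡⟨ coeff-bracket P (alphabetSum k) (c ∷ x) ⟩
  coeff (mulP P (alphabetSum k)) (c ∷ x) - coeff (mulP (alphabetSum k) P) (c ∷ x)
    ≡⟨ cong₂ _-_ (trans (cong (coeff (mulP P (alphabetSum k))) c∷x≡w∷ʳd)
                        (coeff-*letterSum P (alphabet k) w d))
                 (coeff-letterSum* (alphabet k) P c x) ⟩
  multiplicity (alphabet k) d * coeff P w - multiplicity (alphabet k) c * coeff P x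
    ≡⟨ cong₂ (λ y z → y * coeff P w - z * coeff P x)
             (multiplicity-alphabet k d) (multiplicity-alphabet k c) ⟩
  + 1 * coeff P w - + 1 * coeff P x
    ≡⟨ cong₂ _-_ (ℤₚ.*-identityˡ (coeff P w)) (ℤₚ.*-identityˡ (coeff P x)) ⟩
  coeff P w - coeff P x ∎

∷-as-∷ʳ : ∀ {A : Set} (c : A) x → ∃₂ λ w d → c ∷ x ≡ w ∷ʳ d
∷-as-∷ʳ c []      = [] , c , refl
∷-as-∷ʳ c (c′ ∷ x) with ∷-as-∷ʳ c′ x
... | w , d , eq = c ∷ w , d , cong (c ∷_) eq

module _ {k : ℕ} (b : Fin k) where

  onB : Fin k → ℤ → ℤ
  onB c y = if ⌊ c ≟ b ⌋ then y else + 0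

  weight : (ℕ → ℤ) → Word k → ℤ
  weight f []      = + 0
  weight f (c ∷ x) = onB c (f 0) + weight (f ∘ suc) x

  weight-sub : ∀ {f g h : ℕ → ℤ} → (∀ i → h i ≡ f i - g i) →
    ∀ x → weight h x ≡ weight f x - weight g x
  weight-sub h≡f-g []      = refl
  weight-sub {f} {g} {h} h≡f-g (c ∷ x) with c ≟ b
  ... | yes _ = trans (cong₂ _+_ (h≡f-g 0) (weight-sub (h≡f-g ∘ suc) x))
                      (interchange (f 0) (g 0) (weight (f ∘ suc) x) (weight (g ∘ suc) x))
    where
    interchange : ∀ a b c d → (a - b) + (c - d) ≡ (a + c) - (b + d)
    interchange = solve-∀
  ... | no  _ = trans (cong (_+_ (+ 0)) (weight-sub (h≡f-g ∘ suc) x))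
                      (interchange (weight (f ∘ suc) x) (weight (g ∘ suc) x))
    where
    interchange : ∀ c d → + 0 + (c - d) ≡ (+ 0 + c) - (+ 0 + d)
    interchange = solve-∀

  weight-∷ʳ : ∀ f w d → f (length w) ≡ + 0 → weight f (w ∷ʳ d) ≡ weight f w
  weight-∷ʳ f []      d f0≡0 with d ≟ b
  ... | yes _ = trans (ℤₚ.+-identityʳ (f 0)) f0≡0
  ... | no  _ = refl
  weight-∷ʳ f (c ∷ w) d f[w]≡0 = cong (_+_ (onB c (f 0))) (weight-∷ʳ (f ∘ suc) w d f[w]≡0)

  sumOver-positions : ∀ {n} f (u : Vec (Fin k) n) →
    sumOver (positions b u) (f ∘ toℕ) ≡ weight f (toList u)
  sumOver-positions f Vec.[]      = refl
  sumOver-positions f (c Vec.∷ u) = cong (_+_ (onB c (f 0))) (sumOver-positions (f ∘ suc) u)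

  weight-signedBinomial-suc : ∀ j c x →
    weight (signedBinomial (suc j)) (c ∷ x)
      ≡ weight (signedBinomial j) (c ∷ x) - weight (signedBinomial j) x
  weight-signedBinomial-suc j c x = begin
    onB c (signedBinomial j 0) + weight (signedBinomial (suc j) ∘ suc) x
      ≡⟨ cong (_+_ (onB c (signedBinomial j 0)))
              (weight-sub {signedBinomial j ∘ suc} {signedBinomial j} (signedBinomial-pascal j) x) ⟩
    onB c (signedBinomial j 0) + (weight (signedBinomial j ∘ suc) x - weight (signedBinomial j) x)
      ≡⟨ sym (ℤₚ.+-assoc (onB c (signedBinomial j 0)) _ (- weight (signedBinomial j) x)) ⟩
    weight (signedBinomial j) (c ∷ x) - weight (signedBinomial j) x ∎

  iteratedBracket : ℕ → Poly k
  iteratedBracket zero    = letter b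
  iteratedBracket (suc j) = bracket (iteratedBracket j) (alphabetSum k)

  iteratedBracket-lie : ∀ j → InLie (iteratedBracket j)
  iteratedBracket-lie zero    = lie-gen b
  iteratedBracket-lie (suc j) = lie-brk (iteratedBracket-lie j) (letterSum-lie (alphabet k))

  coeff-iteratedBracket : ∀ j x → length x ≡ suc j →
    coeff (iteratedBracket j) x ≡ weight (signedBinomial j) x
  coeff-iteratedBracket zero (c ∷ []) _ with c ≟ b | b ≟ c
  ... | yes _   | yes _   = refl
  ... | yes c≡b | no  b≢c = ⊥-elim (b≢c (sym c≡b))
  ... | no  c≢b | yes b≡c = ⊥-elim (c≢b (sym b≡c))
  ... | no  _   | no  _   = refl
  coeff-iteratedBracket (suc j) (c ∷ x) ∣c∷x∣≡2+j with ∷-as-∷ʳ c x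
  ... | w , d , c∷x≡w∷ʳd = begin
    coeff (iteratedBracket (suc j)) (c ∷ x)
      ≡⟨ coeff-bracket-alphabetSum (iteratedBracket j) c∷x≡w∷ʳd ⟩
    coeff (iteratedBracket j) w - coeff (iteratedBracket j) x
      ≡⟨ cong₂ _-_ (coeff-iteratedBracket j w ∣w∣≡1+j) (coeff-iteratedBracket j x ∣x∣≡1+j) ⟩
    weight (signedBinomial j) w - weight (signedBinomial j) x
      ≡⟨ cong (_- weight (signedBinomial j) x) (sym drop-last) ⟩
    weight (signedBinomial j) (c ∷ x) - weight (signedBinomial j) x
      ≡⟨ sym (weight-signedBinomial-suc j c x) ⟩
    weight (signedBinomial (suc j)) (c ∷ x) ∎
    where
    ∣x∣≡1+j : length x ≡ suc j
    ∣x∣≡1+j = ℕₚ.suc-injective ∣c∷x∣≡2+j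
    ∣w∣≡1+j : length w ≡ suc j
    ∣w∣≡1+j = ℕₚ.suc-injective (begin
      suc (length w)        ≡⟨ ℕₚ.+-comm 1 (length w) ⟩
      length w ℕ.+ 1        ≡⟨ sym (length-++ w) ⟩
      length (w ∷ʳ d)       ≡⟨ cong length (sym c∷x≡w∷ʳd) ⟩
      length (c ∷ x)        ≡⟨ ∣c∷x∣≡2+j ⟩
      suc (suc j)           ∎)
    drop-last : weight (signedBinomial j) (c ∷ x) ≡ weight (signedBinomial j) w
    drop-last = trans (cong (weight (signedBinomial j)) c∷x≡w∷ʳd)
      (weight-∷ʳ (signedBinomial j) w d
        (signedBinomial-out-of-range (ℕₚ.≤-reflexive (sym ∣w∣≡1+j))))

  coeff-iteratedBracket≡N : ∀ n (u : Vec (Fin k) (suc n)) →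
    coeff (iteratedBracket n) (toList u) ≡ N (suc n) (positions b u)
  coeff-iteratedBracket≡N n u = begin
    coeff (iteratedBracket n) (toList u)
      ≡⟨ coeff-iteratedBracket n (toList u) (length-toList u) ⟩
    weight (signedBinomial n) (toList u)
      ≡⟨ sym (sumOver-positions (signedBinomial n) u) ⟩
    sumOver (positions b u) (signedBinomial n ∘ toℕ)
      ≡⟨ sym (N-as-sumOver (suc n) (positions b u)) ⟩
    N (suc n) (positions b u) ∎

corollary5p7 :
    (k : ℕ) (a b : Fin k) → a ≢ b →
    (n : ℕ) (u v w : Vec (Fin k) n) →
    (∀ i → lookup w i ≡ a ⊎ lookup w i ≡ b) → Occurs a w → Occurs b w →
    (m : ℕ) → m ≢ 1 →
    ((¬ (Data.Integer.+ m) ℤD.∣ N n (positions b w) → InSupport m (toList w))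
      × ((p e : ℕ) → m ≡ p → Prime p → n ≡ p ^ e → ¬ p ∣ ∣ positions b w ∣ →
          InSupport m (toList w)))
    × (Twin m (toList u) (toList v) →
        N n (positions b u) ≡ N n (positions b v) [mod m ])
    × (AntiTwin m (toList u) (toList v) →
        N n (positions b u) ≡ - N n (positions b v) [mod m ])
corollary5p7 k a b _ zero    u v w _ (() , _) _ m _
corollary5p7 k a b _ (suc n) u v w _ _        _ m _ =
  (inSupport , inSupport-p^e) , twin , antiTwin
  where
  R : Poly k
  R = iteratedBracket b n

  R-lie : InLie R
  R-lie = iteratedBracket-lie b n

  coeff-R : (x : Vec (Fin k) (suc n)) → coeff R (toList x) ≡ N (suc n) (positions b x)
  coeff-R = coeff-iteratedBracket≡N b n

  inSupport : ¬ (+ m) ℤD.∣ N (suc n) (positions b w) → InSupport m (toList w)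
  inSupport m∤N = R , R-lie , λ m∣coeff →
    m∤N (subst ((+ m) ℤD.∣_) (trans (ℤₚ.+-identityʳ _) (coeff-R w)) m∣coeff)

  inSupport-p^e : (p e : ℕ) → m ≡ p → Prime p → suc n ≡ p ^ e → ¬ p ∣ ∣ positions b w ∣ →
    InSupport m (toList w)
  inSupport-p^e p e refl p-prime 1+n≡p^e p∤∣K∣ =
    inSupport (p∤∣X∣⇒p∤N[p^e] p-prime e 1+n≡p^e (positions b w) p∤∣K∣)

  twin : Twin m (toList u) (toList v) →
    N (suc n) (positions b u) ≡ N (suc n) (positions b v) [mod m ]
  twin T = subst ((+ m) ℤD.∣_) (cong₂ _-_ (coeff-R u) (coeff-R v)) (T R R-lie)

  antiTwin : AntiTwin m (toList u) (toList v) →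
    N (suc n) (positions b u) ≡ - N (suc n) (positions b v) [mod m ]
  antiTwin T = subst ((+ m) ℤD.∣_) (cong₂ (λ x y → x - - y) (coeff-R u) (coeff-R v)) (T R R-lie)
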